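{- For all integers $k\ge 3$ and $r\ge 10k+1$, $\mathcal M_{2,k}^r\to\mathcal M_{2,k}^{r+1}$.
   Context: $\mathbf{LO}_k^r$ is the $r$-ary structure with domain $[k]=\{1,\dots,k\}$ and relation consisting of all tuples in $[k]^r$ with a unique maximum. For $r$-ary structures $\mathbf{A},\mathbf{B}$, a $p$-ary polymorphism is a function $f: A^p\to B$ such that whenever an $r\times p$ matrix has every column in the relation of $\mathbf A$, applying $f$ to each row yields a tuple in the relation of $\mathbf B$. $\mathrm{Pol}(\mathbf A,\mathbf B)$ is the minion of all polymorphisms with minors $f_\pi(x_1,\dots,x_q)=f(x_{\pi(1)},\dots,x_{\pi(p)})$ for $\pi:[p]\to[q]$. $\mathcal{M}_{2,k}^r = \mathrm{Pol}(\mathbf{LO}_2^r,\mathbf{LO}_k^r)$. A minion homomorphism $\xi:\mathcal M\to\mathcal N$ maps $p$-ary elements to $p$-ary elements with $\xi(f)_\pi=\xi(f_\pi)$ for all $\pi,f$; $\mathcal M\to\mathcal N$ means one exists. -}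

module Defs where

open import Data.Nat using (ℕ)
open import Data.Fin using (Fin; _<_)
open import Data.Product using (Σ; ∃; _×_; proj₁; _,_)
open import Relation.Binary.PropositionalEquality using (_≡_; _≢_)

-- Elements of [k] are represented by Fin k (0-based; order-isomorphic to {1,…,k}).

LO : (k r : ℕ) → (Fin r → Fin k) → Set
LO k r t = ∃ λ i → ∀ j → j ≢ i → t j < t i

IsPol : (r k p : ℕ) → ((Fin p → Fin 2) → Fin k) → Set
IsPol r k p f =
  (M : Fin r → Fin p → Fin 2) →
  (∀ c → LO 2 r (λ i → M i c)) →
  LO k r (λ i → f (M i))

Pol : (r k p : ℕ) → Set
Pol r k p = Σ ((Fin p → Fin 2) → Fin k) (IsPol r k p)

minorFun : ∀ {k p q} → (Fin p → Fin q) → ((Fin p → Fin 2) → Fin k) → ((Fin q → Fin 2) → Fin k)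
minorFun π f x = f (λ j → x (π j))

minor : ∀ {r k p q} → (Fin p → Fin q) → Pol r k p → Pol r k q
minor {r} {k} {p} {q} π (f , pf) = minorFun π f , λ M cols → pf (λ i j → M i (π j)) (λ c → cols (π c))

-- Minion homomorphism M_{2,k}^r → M_{2,k'}^{r'}: arity-preserving maps commuting with minors
-- (equality of polymorphisms = equality as functions, i.e. pointwise).
MinionHom : (r k r' k' : ℕ) → Set
MinionHom r k r' k' =
  Σ (∀ p → Pol r k p → Pol r' k' p) λ ξ →
    ∀ p q (π : Fin p → Fin q) (f : Pol r k p) (x : Fin q → Fin 2) →
      proj₁ (ξ q (minor π f)) x ≡ proj₁ (minor π (ξ p f)) x

-- A polymorphism f of LO₂ʳ → LOₖʳ is already one of LO₂ʳ⁺¹ → LOₖʳ⁺¹, so the inclusion of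
-- minions is the homomorphism.  A 0/1 matrix with columns in LO₂ has exactly one 1 per
-- column, and OR-ing its rows along any partition into (possibly empty) blocks keeps this.
-- Suppose on r + 1 rows the values of f have no unique maximum, so rows i ≠ j tie at the
-- top.  Take k + 2 disjoint pairs of further rows; as f takes only k values on their ORs,
-- there are three pairs with values a = b ≥ c.  Merge each of these pairs into one row,
-- leaving its other row empty, and delete one of the three empty rows: r rows remain, and
-- on them f has no unique maximum, since i and j still tie, the two empty rows tie, the
-- merged rows tie or lie below a tie, and every other row lies below the tie of i and j.

module Submission where

open import Defs
open import Data.Nat using (ℕ; _≤_; _<_; _+_; _*_; suc; z≤n; s≤s)
import Data.Nat.Properties as ℕ
open import Data.Nat.Tactic.RingSolver using (solve-∀)
open import Data.Fin as Fin using (Fin; zero; suc; punchIn; punchOut; inject≤; combine)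
open import Data.Fin.Properties as Fin
  using (punchInᵢ≢i; punchIn-injective; punchIn-punchOut; punchOut-punchIn; punchOut-cong;
         punchOut-injective; any?; pigeonhole; _≟_; _≤?_)
open import Data.List using (List; []; _∷_; allFin)
import Data.List.Extrema as Extrema
open import Data.List.Membership.Propositional using (_∈_)
open import Data.List.Membership.Propositional.Properties using (∈-allFin)
import Data.List.Relation.Unary.All as All
open import Data.List.Relation.Unary.Any using (here; there)
open import Data.Product using (∃; ∃₂; _×_; proj₁; proj₂; _,_)
open import Data.Sum using (_⊎_; inj₁; inj₂)
open import Data.Empty using (⊥; ⊥-elim)
open import Function using (_∘_)
open import Function.Definitions using (Injective)
open import Relation.Nullary using (yes; no; ¬?)
open import Relation.Nullary.Decidable using (_×-dec_)
open import Relation.Binary.PropositionalEquality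

module _ {k : ℕ} where
  open Extrema (Fin.≤-totalOrder k)

  -- Opaque so that the folds over allFin are never unfolded by later with-abstractions,
  -- which would otherwise make type checking very slow.
  opaque
   minimiser : ∀ {n} (g : Fin (suc n) → Fin k) → ∃ λ i → ∀ a → g i Fin.≤ g a
   minimiser g = argmin g zero (allFin _) ,
     λ a → All.lookup (f[argmin]≤f[xs] {f = g} zero (allFin _)) (∈-allFin a)

   maximiser : ∀ {n} (g : Fin (suc n) → Fin k) → ∃ λ i → ∀ a → g a Fin.≤ g i
   maximiser g = argmax g zero (allFin _) ,
     λ a → All.lookup (f[xs]≤f[argmax] {f = g} zero (allFin _)) (∈-allFin a)

LO⊎tiedTop : ∀ {n k} (g : Fin (suc n) → Fin k) →
  LO k (suc n) g ⊎ ∃₂ λ i j → i ≢ j × g j ≡ g i × (∀ a → g a Fin.≤ g i)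
LO⊎tiedTop g with maximiser g
... | i , max with any? (λ j → ¬? (j ≟ i) ×-dec (g i ≤? g j))
...   | yes (j , j≢i , gi≤gj) = inj₂ (i , j , j≢i ∘ sym , Fin.≤-antisym (max j) gi≤gj , max)
...   | no ∄ = inj₁ (i , λ j j≢i → ℕ.≰⇒> λ gi≤gj → ∄ (j , j≢i , gi≤gj))

tied⇒<top : ∀ {r k} {v : Fin r → Fin k} {top b b′} → (∀ j → j ≢ top → v j Fin.< v top) →
  b ≢ b′ → v b ≡ v b′ → v b Fin.< v top
tied⇒<top {v = v} {top} {b} {b′} max b≢b′ tie with b ≟ top
... | yes refl = subst (Fin._< v top) (sym tie) (max b′ (b≢b′ ∘ sym))
... | no b≢top = max b b≢top

triple : ∀ {a} {A : Set a} → A → A → A → Fin 3 → A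
triple x y z zero             = x
triple x y z (suc zero)       = y
triple x y z (suc (suc zero)) = z

triple-injective : ∀ {a} {A : Set a} {x y z : A} →
  x ≢ y → x ≢ z → y ≢ z → Injective _≡_ _≡_ (triple x y z)
triple-injective x≢y x≢z y≢z {zero}             {zero}             _ = refl
triple-injective x≢y x≢z y≢z {zero}             {suc zero}         e = ⊥-elim (x≢y e)
triple-injective x≢y x≢z y≢z {zero}             {suc (suc zero)}   e = ⊥-elim (x≢z e)
triple-injective x≢y x≢z y≢z {suc zero}         {zero}             e = ⊥-elim (x≢y (sym e))
triple-injective x≢y x≢z y≢z {suc zero}         {suc zero}         _ = refl
triple-injective x≢y x≢z y≢z {suc zero}         {suc (suc zero)}   e = ⊥-elim (y≢z e)
triple-injective x≢y x≢z y≢z {suc (suc zero)}   {zero}             e = ⊥-elim (x≢z (sym e))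
triple-injective x≢y x≢z y≢z {suc (suc zero)}   {suc zero}         e = ⊥-elim (y≢z (sym e))
triple-injective x≢y x≢z y≢z {suc (suc zero)}   {suc (suc zero)}   _ = refl

-- The third point is a minimiser of g; the first two collide by pigeonhole on the rest.
tiedTriple : ∀ {k} (g : Fin (suc (suc k)) → Fin k) →
  ∃ λ (us : Fin 3 → Fin (suc (suc k))) → Injective _≡_ _≡_ us ×
    g (us zero) ≡ g (us (suc zero)) × g (us (suc (suc zero))) Fin.≤ g (us zero)
tiedTriple {k} g with minimiser g
... | low , min with pigeonhole (ℕ.n<1+n k) (g ∘ punchIn low)
...   | a , b , a<b , ga≡gb =
  triple (punchIn low a) (punchIn low b) low ,
  triple-injective (Fin.<⇒≢ a<b ∘ punchIn-injective low a b) (punchInᵢ≢i low a) (punchInᵢ≢i low b) ,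
  ga≡gb , min (punchIn low a)

_∨_ : Fin 2 → Fin 2 → Fin 2
x ∨ zero  = x
x ∨ suc _ = suc zero

x<y⇒x≡0×y≡1 : ∀ {x y : Fin 2} → x Fin.< y → x ≡ zero × y ≡ suc zero
x<y⇒x≡0×y≡1 {zero}     {suc zero} _ = refl , refl
x<y⇒x≡0×y≡1 {suc zero} {suc zero} (s≤s ())

LO₂-top≡1 : ∀ {n} {t : Fin (suc (suc n)) → Fin 2} o → (∀ j → j ≢ o → t j Fin.< t o) → t o ≡ suc zero
LO₂-top≡1 o max = proj₂ (x<y⇒x≡0×y≡1 (max (punchIn o zero) (punchInᵢ≢i o zero)))

-- Since x ∨ 0 reduces to x, the join of a one-row list is definitionally that row: there is
-- no function extensionality, so this is how f on a merged matrix is related to f on M.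
module _ {R p : ℕ} (M : Fin R → Fin p → Fin 2) where

  joinRows : List (Fin R) → Fin p → Fin 2
  joinRows []       c = zero
  joinRows (a ∷ as) c = M a c ∨ joinRows as c

  joinRows≡0 : ∀ as c → (∀ {a} → a ∈ as → M a c ≡ zero) → joinRows as c ≡ zero
  joinRows≡0 []       c _   = refl
  joinRows≡0 (a ∷ as) c all0
    rewrite joinRows≡0 as c (all0 ∘ there) | all0 (here refl) = refl

  joinRows≡1 : ∀ {as a} c → a ∈ as → M a c ≡ suc zero → joinRows as c ≡ suc zero
  joinRows≡1 {a ∷ as} c (here refl) Mac≡1 with joinRows as c
  ... | zero  = Mac≡1
  ... | suc _ = refl
  joinRows≡1 {a′ ∷ as} c (there a∈as) Mac≡1 rewrite joinRows≡1 c a∈as Mac≡1 = refl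

record Partition (R r : ℕ) : Set where
  field
    block        : Fin r → List (Fin R)
    blockOf      : Fin R → Fin r
    ∈-block      : ∀ a → a ∈ block (blockOf a)
    block-unique : ∀ {a b} → a ∈ block b → blockOf a ≡ b

  blockOf-singleton : ∀ {a a′} → block (blockOf a) ≡ a ∷ [] → blockOf a′ ≡ blockOf a → a′ ≡ a
  blockOf-singleton {a} {a′} single eq with subst (a′ ∈_) (trans (cong block eq) single) (∈-block a′)
  ... | here a′≡a = a′≡a

joinRows-LO : ∀ {n r p} (M : Fin (suc (suc n)) → Fin p → Fin 2) (P : Partition (suc (suc n)) r) →
  (∀ c → LO 2 (suc (suc n)) (λ a → M a c)) →
  ∀ c → LO 2 r (λ b → joinRows M (Partition.block P b) c)
joinRows-LO M P cols c with cols c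
... | o , max = blockOf o , λ b b≢ →
  subst₂ Fin._<_ (sym (joinRows≡0 M (block b) c (λ a∈ → proj₁ (x<y⇒x≡0×y≡1 (max _ (outside b≢ a∈))))))
                 (sym (joinRows≡1 M c (∈-block o) (LO₂-top≡1 o max)))
                 (s≤s z≤n)
  where
    open Partition P
    outside : ∀ {a b} → b ≢ blockOf o → a ∈ block b → a ≢ o
    outside b≢ a∈ refl = b≢ (sym (block-unique a∈))

-- Each pair φ s is merged into the row of φ s 0 and the row of φ s 1 is left empty;
-- the empty row of φ 0 1 is then deleted, so r of the r + 1 rows remain.
module PairCollapse {q r : ℕ} (φ : Fin (suc q) → Fin 2 → Fin (suc r))
  (φ-injective : ∀ {s t s′ t′} → φ s t ≡ φ s′ t′ → s ≡ s′ × t ≡ t′) where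

  pair : Fin (suc q) → List (Fin (suc r))
  pair s = φ s zero ∷ φ s (suc zero) ∷ []

  φ∈pair : ∀ s t → φ s t ∈ pair s
  φ∈pair s zero       = here refl
  φ∈pair s (suc zero) = there (here refl)

  data Kind (a : Fin (suc r)) : Set where
    paired   : ∀ s t → φ s t ≡ a → Kind a
    unpaired : (∀ s t → φ s t ≢ a) → Kind a

  kind : ∀ a → Kind a
  kind a with any? (λ s → any? (λ t → φ s t ≟ a))
  ... | yes (s , t , e) = paired s t e
  ... | no ∄            = unpaired λ s t e → ∄ (s , t , e)

  blockOfKind : ∀ {a} → Kind a → List (Fin (suc r))
  blockOfKind     (paired s zero _)    = pair s
  blockOfKind     (paired s (suc _) _) = []
  blockOfKind {a} (unpaired _)         = a ∷ []

  leaderOfKind : ∀ {a} → Kind a → Fin (suc r)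
  leaderOfKind     (paired s _ _) = φ s zero
  leaderOfKind {a} (unpaired _)   = a

  blockAt : Fin (suc r) → List (Fin (suc r))
  blockAt a = blockOfKind (kind a)

  leader : Fin (suc r) → Fin (suc r)
  leader a = leaderOfKind (kind a)

  blockAt-head : ∀ s → blockAt (φ s zero) ≡ pair s
  blockAt-head s with kind (φ s zero)
  ... | paired s′ t′ e with φ-injective e
  ...   | refl , refl = refl
  blockAt-head s | unpaired ∉ = ⊥-elim (∉ s zero refl)

  blockAt-tail : ∀ s → blockAt (φ s (suc zero)) ≡ []
  blockAt-tail s with kind (φ s (suc zero))
  ... | paired s′ t′ e with φ-injective e
  ...   | refl , refl = refl
  blockAt-tail s | unpaired ∉ = ⊥-elim (∉ s (suc zero) refl)

  blockAt-unpaired : ∀ {a} → (∀ s t → φ s t ≢ a) → blockAt a ≡ a ∷ []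
  blockAt-unpaired {a} ∉ with kind a
  ... | paired s t e = ⊥-elim (∉ s t e)
  ... | unpaired _   = refl

  leader-φ : ∀ s t → leader (φ s t) ≡ φ s zero
  leader-φ s t with kind (φ s t)
  ... | paired s′ t′ e = cong (λ s″ → φ s″ zero) (proj₁ (φ-injective e))
  ... | unpaired ∉     = ⊥-elim (∉ s t refl)

  leader-unpaired : ∀ {a} → (∀ s t → φ s t ≢ a) → leader a ≡ a
  leader-unpaired {a} ∉ with kind a
  ... | paired s t e = ⊥-elim (∉ s t e)
  ... | unpaired _   = refl

  ∈-blockAt-leader : ∀ a → a ∈ blockAt (leader a)
  ∈-blockAt-leader a = go (kind a)
    where
      go : (κ : Kind a) → a ∈ blockAt (leaderOfKind κ)
      go (paired s t refl) = subst (φ s t ∈_) (sym (blockAt-head s)) (φ∈pair s t)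
      go (unpaired ∉)      = subst (a ∈_) (sym (blockAt-unpaired ∉)) (here refl)

  leader-unique : ∀ {a a′} → a ∈ blockAt a′ → leader a ≡ a′
  leader-unique {a′ = a′} = go (kind a′)
    where
      go : ∀ {a} (κ : Kind a′) → a ∈ blockOfKind κ → leader a ≡ a′
      go (paired s zero refl) (here refl)         = leader-φ s zero
      go (paired s zero refl) (there (here refl)) = leader-φ s (suc zero)
      go (unpaired ∉)         (here refl)         = leader-unpaired ∉

  removed : Fin (suc r)
  removed = φ zero (suc zero)

  removed≢leader : ∀ a → removed ≢ leader a
  removed≢leader a = go (kind a)
    where
      go : (κ : Kind a) → removed ≢ leaderOfKind κ
      go (paired s t _) e with φ-injective e
      ... | _ , ()
      go (unpaired ∉) e = ∉ zero (suc zero) e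

  partition : Partition (suc r) r
  partition = record
    { block        = λ b → blockAt (punchIn removed b)
    ; blockOf      = λ a → punchOut (removed≢leader a)
    ; ∈-block      = λ a → subst (λ c → a ∈ blockAt c) (sym (punchIn-punchOut (removed≢leader a)))
                                 (∈-blockAt-leader a)
    ; block-unique = λ a∈ → trans (punchOut-cong removed (leader-unique a∈)) (punchOut-punchIn removed)
    }

  open Partition partition public

  block-blockOf : ∀ a → block (blockOf a) ≡ blockAt (leader a)
  block-blockOf a = cong blockAt (punchIn-punchOut (removed≢leader a))

  headRow : Fin (suc q) → Fin r
  headRow s = blockOf (φ s zero)

  block-headRow : ∀ s → block (headRow s) ≡ pair s
  block-headRow s =
    trans (block-blockOf (φ s zero)) (trans (cong blockAt (leader-φ s zero)) (blockAt-head s))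

  headRow-injective : ∀ {s s′} → headRow s ≡ headRow s′ → s ≡ s′
  headRow-injective {s} {s′} eq
    with subst (φ s zero ∈_) (trans (sym (block-headRow s)) (trans (cong block eq) (block-headRow s′))) (here refl)
  ... | here e = proj₁ (φ-injective e)
  ... | there (here e) with φ-injective e
  ...   | _ , ()

  block-unpaired : ∀ {a} → (∀ s t → φ s t ≢ a) → block (blockOf a) ≡ a ∷ []
  block-unpaired {a} ∉ =
    trans (block-blockOf a) (trans (cong blockAt (leader-unpaired ∉)) (blockAt-unpaired ∉))

  removed≢tail : ∀ s → removed ≢ φ (suc s) (suc zero)
  removed≢tail s e with φ-injective e
  ... | () , _

  emptyRow : Fin q → Fin r
  emptyRow s = punchOut (removed≢tail s)

  block-emptyRow : ∀ s → block (emptyRow s) ≡ []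
  block-emptyRow s = trans (cong blockAt (punchIn-punchOut (removed≢tail s))) (blockAt-tail (suc s))

  emptyRow-injective : Injective _≡_ _≡_ emptyRow
  emptyRow-injective {s} {s′} eq =
    Fin.suc-injective (proj₁ (φ-injective (punchOut-injective (removed≢tail s) (removed≢tail s′) eq)))

  data RowKind (b : Fin r) : Set where
    empty  : block b ≡ [] → RowKind b
    single : ∀ a → block b ≡ a ∷ [] → RowKind b
    merged : ∀ s → b ≡ headRow s → RowKind b

  rowKind : ∀ b → RowKind b
  rowKind b = go (kind (punchIn removed b)) refl
    where
      go : (κ : Kind (punchIn removed b)) → block b ≡ blockOfKind κ → RowKind b
      go (paired s zero _)    eq = merged s (sym (block-unique (subst (φ s zero ∈_) (sym eq) (here refl))))
      go (paired s (suc _) _) eq = empty eq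
      go (unpaired _)         eq = single _ eq

avoiding : ∀ {n} {i j : Fin (suc (suc n))} → i ≢ j → Fin n → Fin (suc (suc n))
avoiding {i = i} i≢j x = punchIn i (punchIn (punchOut i≢j) x)

avoiding-injective : ∀ {n} {i j : Fin (suc (suc n))} (i≢j : i ≢ j) → Injective _≡_ _≡_ (avoiding i≢j)
avoiding-injective {i = i} i≢j = punchIn-injective (punchOut i≢j) _ _ ∘ punchIn-injective i _ _

avoiding≢left : ∀ {n} {i j : Fin (suc (suc n))} (i≢j : i ≢ j) x → avoiding i≢j x ≢ i
avoiding≢left {i = i} i≢j x = punchInᵢ≢i i _

avoiding≢right : ∀ {n} {i j : Fin (suc (suc n))} (i≢j : i ≢ j) x → avoiding i≢j x ≢ j
avoiding≢right {i = i} i≢j x e =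
  punchInᵢ≢i (punchOut i≢j) x (punchIn-injective i _ _ (trans e (sym (punchIn-punchOut i≢j))))

pairValue : ∀ {R p k} → ((Fin p → Fin 2) → Fin k) → (Fin R → Fin p → Fin 2) → (Fin 2 → Fin R) → Fin k
pairValue f M ψ = f (joinRows M (ψ zero ∷ ψ (suc zero) ∷ []))

module _ {n k p : ℕ} (f : (Fin p → Fin 2) → Fin k) (f-pol : IsPol (suc n) k p f)
         {M : Fin (suc (suc n)) → Fin p → Fin 2} (cols : ∀ c → LO 2 (suc (suc n)) (λ a → M a c)) where

  tiedPairs-contradiction : ∀ {i j} → i ≢ j → f (M j) ≡ f (M i) → (∀ a → f (M a) Fin.≤ f (M i)) →
    (φ : Fin 3 → Fin 2 → Fin (suc (suc n))) →
    (∀ {s t s′ t′} → φ s t ≡ φ s′ t′ → s ≡ s′ × t ≡ t′) →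
    (∀ s t → φ s t ≢ i) → (∀ s t → φ s t ≢ j) →
    pairValue f M (φ zero) ≡ pairValue f M (φ (suc zero)) →
    pairValue f M (φ (suc (suc zero))) Fin.≤ pairValue f M (φ zero) → ⊥
  tiedPairs-contradiction {i} {j} i≢j tie fi-max φ φ-injective ∉i ∉j tie₀₁ le₂₀ =
    onTop (f-pol (λ b → joinRows M (block b)) (joinRows-LO M partition cols))
    where
      open PairCollapse φ φ-injective

      v : Fin (suc n) → Fin k
      v b = f (joinRows M (block b))

      v-≡ : ∀ {b as} → block b ≡ as → v b ≡ f (joinRows M as)
      v-≡ = cong (f ∘ joinRows M)

      v-empty : ∀ s → v (emptyRow s) ≡ f (joinRows M [])
      v-empty s = v-≡ (block-emptyRow s)

      v-head : ∀ s → v (headRow s) ≡ pairValue f M (φ s)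
      v-head s = v-≡ (block-headRow s)

      v-unpaired : ∀ {a} → (∀ s t → φ s t ≢ a) → v (blockOf a) ≡ f (M a)
      v-unpaired ∉ = v-≡ (block-unpaired ∉)

      empties-tie : v (emptyRow zero) ≡ v (emptyRow (suc zero))
      empties-tie = trans (v-empty zero) (sym (v-empty (suc zero)))

      heads-tie : v (headRow zero) ≡ v (headRow (suc zero))
      heads-tie = trans (v-head zero) (trans tie₀₁ (sym (v-head (suc zero))))

      tops-tie : v (blockOf i) ≡ v (blockOf j)
      tops-tie = trans (v-unpaired ∉i) (trans (sym tie) (sym (v-unpaired ∉j)))

      iRow≢jRow : blockOf i ≢ blockOf j
      iRow≢jRow eq = i≢j (sym (blockOf-singleton (block-unpaired ∉i) (sym eq)))

      module _ {top} (max : ∀ b → b ≢ top → v b Fin.< v top) where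

        below-tie : ∀ {b b′} → b ≢ b′ → v b ≡ v b′ → v top Fin.≤ v b → ⊥
        below-tie b≢b′ tie′ = ℕ.<⇒≱ (tied⇒<top max b≢b′ tie′)

        onRowKind : RowKind top → ⊥
        onRowKind (empty e) =
          below-tie ((λ ()) ∘ emptyRow-injective) empties-tie
                    (Fin.≤-reflexive (trans (v-≡ e) (sym (v-empty zero))))
        onRowKind (single a e) =
          below-tie iRow≢jRow tops-tie
                    (subst₂ Fin._≤_ (sym (v-≡ e)) (sym (v-unpaired ∉i)) (fi-max a))
        onRowKind (merged zero refl) =
          below-tie ((λ ()) ∘ headRow-injective) heads-tie Fin.≤-refl
        onRowKind (merged (suc zero) refl) =
          below-tie ((λ ()) ∘ headRow-injective) (sym heads-tie) Fin.≤-refl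
        onRowKind (merged (suc (suc zero)) refl) =
          ℕ.<⇒≱ (max (headRow zero) ((λ ()) ∘ headRow-injective))
                 (subst₂ Fin._≤_ (sym (v-head (suc (suc zero)))) (sym (v-head zero)) le₂₀)

      onTop : LO k (suc n) v → ⊥
      onTop (top , max) = onRowKind max (rowKind top)

module _ {n k : ℕ} {i j : Fin (suc (suc n))} (i≢j : i ≢ j) (bound : (2 + k) * 2 ≤ n) where

  pairRows : Fin (2 + k) → Fin 2 → Fin (suc (suc n))
  pairRows u t = avoiding i≢j (inject≤ (combine u t) bound)

  pairRows∘-injective : ∀ {m} {us : Fin m → Fin (2 + k)} → Injective _≡_ _≡_ us →
    ∀ {s t s′ t′} → pairRows (us s) t ≡ pairRows (us s′) t′ → s ≡ s′ × t ≡ t′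
  pairRows∘-injective us-injective eq
    with Fin.combine-injective _ _ _ _ (Fin.inject≤-injective bound bound _ _ (avoiding-injective i≢j eq))
  ... | u≡u′ , t≡t′ = us-injective u≡u′ , t≡t′

IsPol-suc : ∀ {n k p} {f : (Fin p → Fin 2) → Fin k} →
  (2 + k) * 2 ≤ n → IsPol (suc n) k p f → IsPol (suc (suc n)) k p f
IsPol-suc {f = f} bound f-pol M cols with LO⊎tiedTop (λ a → f (M a))
... | inj₁ unique = unique
... | inj₂ (i , j , i≢j , tie , fi-max) with tiedTriple (pairValue f M ∘ pairRows i≢j bound)
...   | us , us-injective , tie₀₁ , le₂₀ =
  ⊥-elim (tiedPairs-contradiction f f-pol cols i≢j tie fi-max (pairRows i≢j bound ∘ us)
            (pairRows∘-injective i≢j bound us-injective)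
            (λ _ _ → avoiding≢left i≢j _) (λ _ _ → avoiding≢right i≢j _) tie₀₁ le₂₀)

IsPol-+1 : ∀ {r k p} {f : (Fin p → Fin 2) → Fin k} →
  (2 + k) * 2 < r → IsPol r k p f → IsPol (r + 1) k p f
IsPol-+1 {suc n} {k} {p} {f} (s≤s bound) f-pol =
  subst (λ R → IsPol R k p f) (ℕ.+-comm 1 (suc n)) (IsPol-suc {f = f} bound f-pol)

polymorphism-inclusion : ∀ {r r′ k} → (∀ {p f} → IsPol r k p f → IsPol r′ k p f) → MinionHom r k r′ k
polymorphism-inclusion ⊆ = (λ p (f , f-pol) → f , ⊆ {p} {f} f-pol) , λ _ _ _ _ _ → refl

pairsFit : ∀ {k} → 1 ≤ k → (2 + k) * 2 < 10 * k + 1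
pairsFit {suc k} _ = subst (suc ((2 + suc k) * 2) ≤_) (sym (identity k)) (ℕ.m≤m+n _ _)
  where
    identity : ∀ k → 10 * suc k + 1 ≡ suc ((2 + suc k) * 2) + (8 * k + 4)
    identity = solve-∀

theorem5p19 : (k r : ℕ) → 3 ≤ k → 10 * k + 1 ≤ r → MinionHom r k (r + 1) k
theorem5p19 k r k≥3 r≥10k+1 =
  polymorphism-inclusion λ {_} {f} → IsPol-+1 {f = f} (ℕ.<-≤-trans (pairsFit (ℕ.≤-trans (s≤s z≤n) k≥3)) r≥10k+1)
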